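{- Let $a_1,\dots,a_k$ be positive integers with $\sum_{i=1}^k 1/a_i\ge 2$. Then $(a_1,\dots,a_k)$ is good.
   Context: A tuple $(a_1,\dots,a_k)$ of positive integers is good if there are sets $S_1,\dots,S_k\subseteq\mathbb{R}$ such that any two distinct elements of $S_i$ differ by at least $a_i$ and every integer belongs to $S_1\cup\dots\cup S_k$; otherwise it is bad. -}

module Defs where

open import Data.Nat using (ℕ; zero; suc)
open import Data.Fin using (Fin; zero; suc)
open import Data.Integer using (ℤ; +_; _-_; ∣_∣)
open import Data.Rational using (ℚ; 0ℚ; _/_; _+_)
open import Data.Product using (Σ; ∃; _×_)
open import Relation.Binary.PropositionalEquality using (_≢_)

-- 1/a as a rational number; only used for positive a (for a = 0 it is 0, irrelevant).
recip : ℕ → ℚ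
recip zero = 0ℚ
recip (suc n) = + 1 / suc n

sumℚ : (k : ℕ) → (Fin k → ℚ) → ℚ
sumℚ zero f = 0ℚ
sumℚ (suc k) f = f zero + sumℚ k (λ i → f (suc i))

Good : (k : ℕ) → (Fin k → ℕ) → Set₁
Good k a =
  Σ (Fin k → ℤ → Set) λ S →
    (∀ i x y → S i x → S i y → x ≢ y → a i Data.Nat.≤ ∣ x - y ∣)
    × (∀ (n : ℤ) → ∃ λ i → S i n)

module Submission where

-- Round each a_i up to a power of two 2^(e_i) ≤ 2 a_i, so that Σ 2^(-e_i) ≥ 1. Two members of one
-- residue class mod 2^(e_i) differ by at least 2^(e_i) ≥ a_i, so it suffices to cover ℤ by classes
-- r_i mod 2^(e_i). These are allotted greedily from the coarsest modulus down: a class mod 2^d,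
-- given unassigned indices of total weight Σ 2^(-e_i) ≥ 2^(-d), all with e_i ≥ d, is covered by one
-- unassigned index of exponent d if there is one, and otherwise by covering its two subclasses
-- mod 2^(d+1) in turn, each consuming exactly half the required weight. At the largest exponent
-- the weight bound forces an index of exponent d to be left.

open import Defs using (recip; sumℚ; Good)
open import Data.Nat as ℕ using (ℕ; zero; suc; _+_; _*_; _∸_; _^_; _≤_; z≤n; s≤s)
open import Data.Nat.Properties
open import Data.Nat.Divisibility using (∣⇒≤)
open import Data.Fin using (Fin; zero; suc)
open import Data.Fin.Properties using (any?; punchInᵢ≢i)
open import Data.Rational as ℚ using (ℚ; toℚᵘ)
import Data.Rational.Properties as ℚ
open import Data.Rational.Unnormalised as ℚᵘ using (mkℚᵘ; *≤*; *≡*)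
import Data.Rational.Unnormalised.Properties as ℚᵘ
open import Data.Integer as ℤ using (ℤ; +_; ∣_∣)
import Data.Integer.Properties as ℤ
open import Data.Integer.DivMod using (_/ℕ_; _%ℕ_; a≡a%ℕn+[a/ℕn]*n; n%ℕd<d)
open import Data.Integer.Divisibility.Signed using (_∣_; divides; ∣⇒∣ᵤ; ∣m⇒∣-m; ∣m∣n⇒∣m+n)
open import Data.Integer.Tactic.RingSolver using (solve-∀)
open import Data.Maybe using (Maybe; just; nothing; maybe′)
open import Data.Maybe.Properties using (just-injective) renaming (≡-dec to ≡-dec-Maybe)
open import Data.Product using (∃; _×_; _,_; proj₁; proj₂)
open import Data.Sum using (_⊎_; inj₁; inj₂)
open import Data.Vec.Functional using (updateAt; removeAt)
open import Data.Vec.Functional.Properties using (updateAt-updates; updateAt-minimal)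
open import Function using (id; const; _∘_)
open import Relation.Nullary using (Dec; yes; no; contradiction)
open import Relation.Nullary.Decidable using (_×-dec_)
open import Relation.Binary.PropositionalEquality
open import Algebra.Properties.Semiring.Sum +-*-semiring
  using (sum; sum-remove; sum-cong-≗; sum-replicate-zero; *-distribˡ-sum)
open import Algebra.Properties.CommutativeSemigroup +-commutativeSemigroup using (xy∙z≈xz∙y)

infix 4 _≡_mod_

_≡_mod_ : ℤ → ℤ → ℕ → Set
x ≡ y mod m = + m ∣ x ℤ.- y

≡-mod-sym : ∀ {m x y} → x ≡ y mod m → y ≡ x mod m
≡-mod-sym {m} {x} {y} = subst (+ m ∣_) (negate-diff x y) ∘ ∣m⇒∣-m
  where
  negate-diff : ∀ x y → ℤ.- (x ℤ.- y) ≡ y ℤ.- x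
  negate-diff = solve-∀

≡-mod-trans : ∀ {m x y z} → x ≡ y mod m → y ≡ z mod m → x ≡ z mod m
≡-mod-trans {m} {x} {y} {z} p q = subst (+ m ∣_) (telescope x y z) (∣m∣n⇒∣m+n p q)
  where
  telescope : ∀ x y z → (x ℤ.- y) ℤ.+ (y ℤ.- z) ≡ x ℤ.- z
  telescope = solve-∀

≡-mod-1 : ∀ x y → x ≡ y mod 1
≡-mod-1 x y = divides (x ℤ.- y) (sym (ℤ.*-identityʳ _))

≡-mod-split : ∀ x t m → x ≡ t mod m → (x ≡ t mod 2 * m) ⊎ (x ≡ t ℤ.+ + m mod 2 * m)
≡-mod-split x t m (divides q x-t≡qm)
  with q %ℕ 2 | a≡a%ℕn+[a/ℕn]*n q 2 | n%ℕd<d q 2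
... | 0 | q≡2h | _ = inj₁ (divides (q /ℕ 2) (begin
  x ℤ.- t                      ≡⟨ x-t≡qm ⟩
  q ℤ.* + m                    ≡⟨ cong (ℤ._* + m) q≡2h ⟩
  (+ 0 ℤ.+ h ℤ.* + 2) ℤ.* + m  ≡⟨ even h (+ m) ⟩
  h ℤ.* (+ 2 ℤ.* + m)          ≡⟨ cong (h ℤ.*_) (ℤ.pos-* 2 m) ⟨
  h ℤ.* + (2 * m)              ∎))
  where
  open ≡-Reasoning
  h : ℤ
  h = q /ℕ 2
  even : ∀ h m → (+ 0 ℤ.+ h ℤ.* + 2) ℤ.* m ≡ h ℤ.* (+ 2 ℤ.* m)
  even = solve-∀
... | 1 | q≡2h+1 | _ = inj₂ (divides (q /ℕ 2) (begin
  x ℤ.- (t ℤ.+ + m)                          ≡⟨ shift x t (+ m) ⟩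
  (x ℤ.- t) ℤ.- + m                          ≡⟨ cong (ℤ._- + m) x-t≡qm ⟩
  q ℤ.* + m ℤ.- + m                          ≡⟨ cong (λ q → q ℤ.* + m ℤ.- + m) q≡2h+1 ⟩
  (+ 1 ℤ.+ h ℤ.* + 2) ℤ.* + m ℤ.- + m        ≡⟨ odd h (+ m) ⟩
  h ℤ.* (+ 2 ℤ.* + m)                        ≡⟨ cong (h ℤ.*_) (ℤ.pos-* 2 m) ⟨
  h ℤ.* + (2 * m)                            ∎))
  where
  open ≡-Reasoning
  h : ℤ
  h = q /ℕ 2
  shift : ∀ x t m → x ℤ.- (t ℤ.+ m) ≡ (x ℤ.- t) ℤ.- m
  shift = solve-∀
  odd : ∀ h m → (+ 1 ℤ.+ h ℤ.* + 2) ℤ.* m ℤ.- m ≡ h ℤ.* (+ 2 ℤ.* m)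
  odd = solve-∀
... | suc (suc _) | _ | s≤s (s≤s ())

≡-mod⇒≤∣-∣ : ∀ {m x y} → x ≡ y mod m → x ≢ y → m ≤ ∣ x ℤ.- y ∣
≡-mod⇒≤∣-∣ {m} {x} {y} x≡y x≢y = ∣⇒≤ {{x-y≢0}} (∣⇒∣ᵤ x≡y)
  where
  x-y≢0 : ℕ.NonZero ∣ x ℤ.- y ∣
  x-y≢0 = ℕ.≢-nonZero (x≢y ∘ ℤ.i-j≡0⇒i≡j x y ∘ ℤ.∣i∣≡0⇒i≡0)

≤-sum : ∀ {n} (f : Fin n → ℕ) i → f i ≤ sum f
≤-sum {suc n} f i = subst (f i ≤_) (sym (sum-remove f)) (m≤m+n (f i) _)

sum-≡-except : ∀ {n} (f g : Fin n → ℕ) i c → f i ≡ g i + c → (∀ j → j ≢ i → f j ≡ g j) →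
               sum f ≡ sum g + c
sum-≡-except {suc n} f g i c fi≡gi+c f≗g-off-i = begin
  sum f                          ≡⟨ sum-remove f ⟩
  f i + sum (removeAt f i)       ≡⟨ cong₂ _+_ fi≡gi+c (sum-cong-≗ (f≗g-off-i _ ∘ punchInᵢ≢i i)) ⟩
  g i + c + sum (removeAt g i)   ≡⟨ xy∙z≈xz∙y (g i) c _ ⟩
  g i + sum (removeAt g i) + c   ≡⟨ cong (_+ c) (sum-remove g) ⟨
  sum g + c                      ∎
  where
  open ≡-Reasoning

dyadic-ceiling : ∀ n → 1 ≤ n → ∃ λ e → n ≤ 2 ^ e × 2 ^ e ≤ 2 * n
dyadic-ceiling 1 _ = 0 , ≤-refl , s≤s z≤n
dyadic-ceiling (suc n@(suc _)) _ with dyadic-ceiling n (s≤s z≤n)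
... | e , n≤2^e , 2^e≤2n with suc n ≤? 2 ^ e
...   | yes n<2^e = e , n<2^e , ≤-trans 2^e≤2n (*-monoʳ-≤ 2 (n≤1+n n))
...   | no  n≮2^e = suc e , n<2^[1+e] , *-monoʳ-≤ 2 (≤-trans (≤-reflexive 2^e≡n) (n≤1+n n))
  where
  2^e≡n : 2 ^ e ≡ n
  2^e≡n = ≤-antisym (≤-pred (≰⇒> n≮2^e)) n≤2^e
  n<2^[1+e] : n ℕ.< 2 ^ suc e
  n<2^[1+e] = subst (ℕ._< 2 ^ suc e) 2^e≡n (^-monoʳ-< 2 (n<1+n 1) (n<1+n e))

mkℚᵘ-≤ : ∀ {a b M N} → mkℚᵘ (+ a) M ℚᵘ.≤ mkℚᵘ (+ b) N → a * suc N ≤ b * suc M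
mkℚᵘ-≤ {a} {b} {M} {N} (*≤* a[1+N]≤b[1+M]) =
  ℤ.drop‿+≤+ (subst₂ ℤ._≤_ (sym (ℤ.pos-* a (suc N))) (sym (ℤ.pos-* b (suc M))) a[1+N]≤b[1+M])

mkℚᵘ-+ : ∀ a b N → mkℚᵘ (+ a) N ℚᵘ.+ mkℚᵘ (+ b) N ℚᵘ.≃ mkℚᵘ (+ (a + b)) N
mkℚᵘ-+ a b N = *≡* (begin
  (+ a ℤ.* D ℤ.+ + b ℤ.* D) ℤ.* D  ≡⟨ distrib (+ a) (+ b) D ⟩
  (+ a ℤ.+ + b) ℤ.* (D ℤ.* D)      ≡⟨ cong₂ ℤ._*_ (ℤ.pos-+ a b) (ℤ.pos-* (suc N) (suc N)) ⟨
  + (a + b) ℤ.* + (suc N * suc N)  ∎)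
  where
  open ≡-Reasoning
  D : ℤ
  D = + suc N
  distrib : ∀ a b D → (a ℤ.* D ℤ.+ b ℤ.* D) ℤ.* D ≡ (a ℤ.+ b) ℤ.* (D ℤ.* D)
  distrib = solve-∀

recip≤ : ∀ {a} c N → 1 ≤ a → suc N ≤ c * a → toℚᵘ (recip a) ℚᵘ.≤ mkℚᵘ (+ c) N
recip≤ {suc n} c N _ 1+N≤ca = ℚᵘ.≤-respˡ-≃ (ℚᵘ.≃-sym (ℚ.toℚᵘ-fromℚᵘ (mkℚᵘ (+ 1) n)))
  (*≤* (subst₂ ℤ._≤_ (ℤ.pos-* 1 (suc N)) (ℤ.pos-* c (suc n)) (ℤ.+≤+ 1*[1+N]≤ca)))
  where
  1*[1+N]≤ca : 1 * suc N ≤ c * suc n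
  1*[1+N]≤ca = subst (_≤ c * suc n) (sym (*-identityˡ (suc N))) 1+N≤ca

sumℚ≤ : ∀ k (f : Fin k → ℚ) (c : Fin k → ℕ) N →
        (∀ i → toℚᵘ (f i) ℚᵘ.≤ mkℚᵘ (+ c i) N) → toℚᵘ (sumℚ k f) ℚᵘ.≤ mkℚᵘ (+ sum c) N
sumℚ≤ zero    f c N f≤c = *≤* ℤ.≤-refl
sumℚ≤ (suc k) f c N f≤c =
  ℚᵘ.≤-respˡ-≃ (ℚᵘ.≃-sym (ℚ.toℚᵘ-homo-+ (f zero) (sumℚ k (f ∘ suc))))
    (ℚᵘ.≤-respʳ-≃ (mkℚᵘ-+ (c zero) (sum (c ∘ suc)) N)
      (ℚᵘ.+-mono-≤ (f≤c zero) (sumℚ≤ k (f ∘ suc) (c ∘ suc) N (f≤c ∘ suc))))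

kraft : ∀ {k} (a e : Fin k → ℕ) M → (∀ i → 1 ≤ a i) → (∀ i → 2 ^ e i ≤ 2 * a i) →
        (∀ i → e i ≤ M) → + 2 ℚ./ 1 ℚ.≤ sumℚ k (recip ∘ a) → 2 ^ M ≤ sum (λ i → 2 ^ (M ∸ e i))
kraft {k} a e M 1≤a 2^e≤2a e≤M 2≤Σ = *-cancelˡ-≤ 2 (begin
  2 * 2 ^ M                ≡⟨ cong (2 *_) (suc-pred (2 ^ M)) ⟨
  2 * suc N                ≤⟨ mkℚᵘ-≤ (ℚᵘ.≤-trans (ℚ.toℚᵘ-mono-≤ 2≤Σ) Σrecip-a≤Σ2w/2^M) ⟩
  sum (λ i → 2 * w i) * 1  ≡⟨ *-identityʳ _ ⟩
  sum (λ i → 2 * w i)      ≡⟨ *-distribˡ-sum 2 w ⟨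
  2 * sum w                ∎)
  where
  open ≤-Reasoning
  w : Fin k → ℕ
  w i = 2 ^ (M ∸ e i)
  instance
    2^M≢0 : ℕ.NonZero (2 ^ M)
    2^M≢0 = m^n≢0 2 M
  N : ℕ
  N = ℕ.pred (2 ^ M)
  recip-a≤2w/2^M : ∀ i → toℚᵘ (recip (a i)) ℚᵘ.≤ mkℚᵘ (+ (2 * w i)) N
  recip-a≤2w/2^M i = recip≤ (2 * w i) N (1≤a i) (begin
    suc N                ≡⟨ suc-pred (2 ^ M) ⟩
    2 ^ M                ≡⟨ cong (2 ^_) (m∸n+n≡m (e≤M i)) ⟨
    2 ^ (M ∸ e i + e i)  ≡⟨ ^-distribˡ-+-* 2 (M ∸ e i) (e i) ⟩
    w i * 2 ^ e i        ≤⟨ *-monoʳ-≤ (w i) (2^e≤2a i) ⟩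
    w i * (2 * a i)      ≡⟨ *-assoc (w i) 2 (a i) ⟨
    w i * 2 * a i        ≡⟨ cong (_* a i) (*-comm (w i) 2) ⟩
    2 * w i * a i        ∎)
  Σrecip-a≤Σ2w/2^M : toℚᵘ (sumℚ k (recip ∘ a)) ℚᵘ.≤ mkℚᵘ (+ sum (λ i → 2 * w i)) N
  Σrecip-a≤Σ2w/2^M = sumℚ≤ k (recip ∘ a) (λ i → 2 * w i) N recip-a≤2w/2^M

half-remains : ∀ {a c c'} → 2 * a ≤ c → c ≡ c' + a → a ≤ c'
half-remains {a} {c} {c'} 2a≤c refl =
  +-cancelʳ-≤ a a c' (subst (_≤ c' + a) (cong (_+_ a) (+-identityʳ a)) 2a≤c)

module DyadicCovering {k} (e : Fin k → ℕ) (M : ℕ) (e≤M : ∀ i → e i ≤ M) where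

  Assignment : Set
  Assignment = Fin k → Maybe ℤ

  _⊑_ : Assignment → Assignment → Set
  σ ⊑ τ = ∀ i {z} → σ i ≡ just z → τ i ≡ just z

  ⊑-trans : ∀ {σ τ υ} → σ ⊑ τ → τ ⊑ υ → σ ⊑ υ
  ⊑-trans σ⊑τ τ⊑υ i = τ⊑υ i ∘ σ⊑τ i

  ⊑-unassigned : ∀ {σ τ} → σ ⊑ τ → ∀ i → τ i ≡ nothing → σ i ≡ nothing
  ⊑-unassigned {σ} σ⊑τ i τi≡nothing with σ i in σi≡
  ... | nothing = refl
  ... | just z  = contradiction (trans (sym τi≡nothing) (σ⊑τ i σi≡)) λ ()

  InClass : Assignment → Fin k → ℤ → Set
  InClass σ i x = ∃ λ z → σ i ≡ just z × (x ≡ z mod 2 ^ e i)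

  Covered : Assignment → ℤ → Set
  Covered σ x = ∃ λ i → InClass σ i x

  ⊑-covered : ∀ {σ τ} → σ ⊑ τ → ∀ {x} → Covered σ x → Covered τ x
  ⊑-covered σ⊑τ (i , z , σi≡z , x≡z) = i , z , σ⊑τ i σi≡z , x≡z

  -- capacity σ = 2^M · Σ 2^(-e i) over the indices i left unassigned by σ
  spare : Assignment → Fin k → ℕ
  spare σ i = maybe′ (const 0) (2 ^ (M ∸ e i)) (σ i)

  capacity : Assignment → ℕ
  capacity σ = sum (spare σ)

  record Filling (f d : ℕ) (t : ℤ) (σ : Assignment) : Set where
    field
      τ        : Assignment
      extends  : σ ⊑ τ
      consumes : capacity σ ≡ capacity τ + 2 ^ f
      covers   : ∀ x → x ≡ t mod 2 ^ d → Covered τ x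

  assign : ∀ {f d} t σ i → d + f ≡ M → σ i ≡ nothing → e i ≡ d → Filling f d t σ
  assign {f} {d} t σ i d+f≡M σi≡nothing ei≡d = record
    { τ        = τ
    ; extends  = extends
    ; consumes = sum-≡-except (spare σ) (spare τ) i (2 ^ f) spare-i spare-others
    ; covers   = covers
    }
    where
    τ : Assignment
    τ = updateAt σ i (const (just t))
    extends : σ ⊑ τ
    extends j σj≡z = trans (updateAt-minimal j i σ j≢i) σj≡z
      where
      j≢i : j ≢ i
      j≢i refl = contradiction (trans (sym σi≡nothing) σj≡z) λ ()
    spare-i : spare σ i ≡ spare τ i + 2 ^ f
    spare-i rewrite σi≡nothing | updateAt-updates i {const (just t)} σ | ei≡d | sym d+f≡M
                  | m+n∸m≡n d f = refl
    spare-others : ∀ j → j ≢ i → spare σ j ≡ spare τ j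
    spare-others j j≢i = cong (maybe′ (const 0) _) (sym (updateAt-minimal j i σ j≢i))
    covers : ∀ x → x ≡ t mod 2 ^ d → Covered τ x
    covers x x≡t = i , t , updateAt-updates i σ , subst (λ m → x ≡ t mod 2 ^ m) (sym ei≡d) x≡t

  capacity-exhausted : ∀ σ → (∀ i → σ i ≢ nothing) → capacity σ ≡ 0
  capacity-exhausted σ assigned = trans (sum-cong-≗ spare≡0) (sum-replicate-zero k)
    where
    spare≡0 : ∀ i → spare σ i ≡ 0
    spare≡0 i with σ i in σi≡
    ... | just _  = refl
    ... | nothing = contradiction σi≡ (assigned i)

  unassigned-with-exponent? : ∀ (σ : Assignment) d → Dec (∃ λ i → σ i ≡ nothing × e i ≡ d)
  unassigned-with-exponent? σ d = any? λ i → ≡-dec-Maybe ℤ._≟_ (σ i) nothing ×-dec e i ℕ.≟ d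

  combine-halves : ∀ {f d t σ} (F : Filling f (suc d) t σ) →
                   Filling f (suc d) (t ℤ.+ + 2 ^ d) (Filling.τ F) → Filling (suc f) d t σ
  combine-halves {f} {d} {t} {σ} F G = record
    { τ        = G.τ
    ; extends  = ⊑-trans F.extends G.extends
    ; consumes = begin
        capacity σ                       ≡⟨ F.consumes ⟩
        capacity F.τ + 2 ^ f             ≡⟨ cong (_+ 2 ^ f) G.consumes ⟩
        capacity G.τ + 2 ^ f + 2 ^ f     ≡⟨ +-assoc (capacity G.τ) (2 ^ f) (2 ^ f) ⟩
        capacity G.τ + (2 ^ f + 2 ^ f)   ≡⟨ cong (λ n → capacity G.τ + (2 ^ f + n)) (+-identityʳ _) ⟨
        capacity G.τ + 2 ^ suc f         ∎
    ; covers   = covers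
    }
    where
    module F = Filling F
    module G = Filling G
    open ≡-Reasoning
    covers : ∀ x → x ≡ t mod 2 ^ d → Covered G.τ x
    covers x x≡t with ≡-mod-split x t (2 ^ d) x≡t
    ... | inj₁ x≡t      = ⊑-covered G.extends {x} (F.covers x x≡t)
    ... | inj₂ x≡t+2^d  = G.covers x x≡t+2^d

  fill : ∀ f d → d + f ≡ M → ∀ t σ → (∀ i → σ i ≡ nothing → d ≤ e i) → 2 ^ f ≤ capacity σ →
         Filling f d t σ
  fill f d d+f≡M t σ unassigned⇒d≤e room with unassigned-with-exponent? σ d
  ... | yes (i , σi≡nothing , ei≡d) = assign t σ i d+f≡M σi≡nothing ei≡d
  fill zero d d+0≡M t σ unassigned⇒d≤e room | no none =
    contradiction (subst (1 ≤_) (capacity-exhausted σ assigned) room) λ ()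
    where
    assigned : ∀ i → σ i ≢ nothing
    assigned i σi≡nothing = none (i , σi≡nothing , ≤-antisym e≤d (unassigned⇒d≤e i σi≡nothing))
      where
      e≤d : e i ≤ d
      e≤d = subst (e i ≤_) (trans (sym d+0≡M) (+-identityʳ d)) (e≤M i)
  fill (suc f) d d+1+f≡M t σ unassigned⇒d≤e room | no none = combine-halves F G
    where
    1+d+f≡M : suc d + f ≡ M
    1+d+f≡M = trans (sym (+-suc d f)) d+1+f≡M
    unassigned⇒d<e : ∀ {υ} → σ ⊑ υ → ∀ i → υ i ≡ nothing → suc d ≤ e i
    unassigned⇒d<e σ⊑υ i υi≡nothing =
      ≤∧≢⇒< (unassigned⇒d≤e i σi≡nothing) λ d≡ei → none (i , σi≡nothing , sym d≡ei)
      where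
      σi≡nothing : σ i ≡ nothing
      σi≡nothing = ⊑-unassigned σ⊑υ i υi≡nothing
    F : Filling f (suc d) t σ
    F = fill f (suc d) 1+d+f≡M t σ (unassigned⇒d<e (λ _ → id)) (≤-trans (m≤m+n (2 ^ f) _) room)
    G : Filling f (suc d) (t ℤ.+ + 2 ^ d) (Filling.τ F)
    G = fill f (suc d) 1+d+f≡M (t ℤ.+ + 2 ^ d) (Filling.τ F) (unassigned⇒d<e (Filling.extends F))
             (half-remains room (Filling.consumes F))

  cover-ℤ : 2 ^ M ≤ sum (λ i → 2 ^ (M ∸ e i)) → ∃ λ τ → ∀ x → Covered τ x
  cover-ℤ room = Filling.τ F , λ x → Filling.covers F x (≡-mod-1 x (+ 0))
    where
    F : Filling M 0 (+ 0) (const nothing)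
    F = fill M 0 refl (+ 0) (const nothing) (λ _ _ → z≤n) room

  InClass-spaced : ∀ τ i {x y} → InClass τ i x → InClass τ i y → x ≢ y → 2 ^ e i ≤ ∣ x ℤ.- y ∣
  InClass-spaced τ i {x} {y} (z , τi≡z , x≡z) (z' , τi≡z' , y≡z') =
    ≡-mod⇒≤∣-∣ {x = x} {y} (≡-mod-trans {x = x} {z} {y} x≡z (≡-mod-sym {x = y} y≡z))
    where
    y≡z : y ≡ z mod 2 ^ e i
    y≡z = subst (λ w → y ≡ w mod 2 ^ e i) (just-injective (trans (sym τi≡z') τi≡z)) y≡z'

theorem6 : (k : ℕ) (a : Fin k → ℕ) → (∀ i → 1 ≤ a i) → (+ 2 ℚ./ 1) ℚ.≤ sumℚ k (λ i → recip (a i)) →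
           Good k a
theorem6 k a 1≤a 2≤Σ = InClass τ , spaced , proj₂ covering
  where
  rounding : ∀ i → ∃ λ e → a i ≤ 2 ^ e × 2 ^ e ≤ 2 * a i
  rounding i = dyadic-ceiling (a i) (1≤a i)
  e : Fin k → ℕ
  e i = proj₁ (rounding i)
  open DyadicCovering e (sum e) (≤-sum e)
  covering : ∃ λ τ → ∀ x → Covered τ x
  covering = cover-ℤ (kraft a e (sum e) 1≤a (λ i → proj₂ (proj₂ (rounding i))) (≤-sum e) 2≤Σ)
  τ : Assignment
  τ = proj₁ covering
  spaced : ∀ i x y → InClass τ i x → InClass τ i y → x ≢ y → a i ≤ ∣ x ℤ.- y ∣
  spaced i x y x∈i y∈i x≢y = ≤-trans (proj₁ (proj₂ (rounding i))) (InClass-spaced τ i x∈i y∈i x≢y)
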